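{- Let $\mathcal{M}=(M_i\colon i\in K)$ be a family of matroids on a common ground set $E$ which admits a covering. Then for every nonempty family $(X_\alpha\colon \alpha<\kappa)$ of $\mathcal{M}$-tight sets, both $\bigcup_{\alpha<\kappa}X_\alpha$ and $\bigcap_{\alpha<\kappa}X_\alpha$ are $\mathcal{M}$-tight.
   Context: Matroids are possibly infinite: a matroid on $E$ is $(E,\mathcal{I})$ with $\mathcal{I}\subseteq\mathcal{P}(E)$ such that $\emptyset\in\mathcal{I}$; $\mathcal{I}$ is closed under subsets; whenever $I,B\in\mathcal{I}$ with $B$ maximal and $I$ not maximal there is $x\in B\setminus I$ with $I\cup\{x\}\in\mathcal{I}$; and for every $X\subseteq E$ every independent $I\subseteq X$ extends to a maximal element of $\mathcal{I}\cap\mathcal{P}(X)$. Circuits are minimal dependent sets. $X$ spans $e$ in $M$ if $e\in X$ or there is a circuit $C\ni e$ with $C\setminus\{e\}\subseteq X$; $A$ is spanning in a matroid on ground set $Y$ if it spans every element of $Y$. The restriction $M\restriction X$ is $(X,\mathcal{I}\cap\mathcal{P}(X))$, and $\mathcal{M}\restriction X=(M_i\restriction X\colon i\in K)$. A covering of a family $(N_i\colon i\in K)$ of matroids on a common ground set $Y$ is a family $(R_i\colon i\in K)$ with $R_i$ independent in $N_i$ and $\bigcup_iR_i=Y$. Such a family is tight if it admits a covering and in every covering each $R_i$ is spanning in $N_i$. A set $X\subseteq E$ is $\mathcal{M}$-tight if $\mathcal{M}\restriction X$ is tight. Here $\kappa\ge 1$ is a cardinal. -}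

module Defs where

open import Level using (0ℓ)
open import Data.Empty using (⊥)
open import Data.Unit using (⊤)
open import Data.Product using (Σ; ∃; ∃-syntax; _×_; _,_)
open import Data.Sum using (_⊎_)
open import Relation.Nullary using (¬_)
open import Relation.Binary.PropositionalEquality using (_≡_)

Subset : Set → Set₁
Subset E = E → Set

module _ {E : Set} where

  _⊆_ : Subset E → Subset E → Set
  A ⊆ B = ∀ e → A e → B e

  ∅ : Subset E
  ∅ _ = ⊥

  _+ₛ_ : Subset E → E → Subset E
  (I +ₛ x) y = I y ⊎ y ≡ x

-- A (possibly infinite) matroid on the ground set E (the whole type),
-- given by its independent sets.
record Matroid (E : Set) : Set₁ where
  field
    Ind : Subset E → Set

  MaximalIn : Subset E → Subset E → Set₁
  MaximalIn X B = B ⊆ X × Ind B × (∀ J → J ⊆ X → Ind J → B ⊆ J → J ⊆ B)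

  Maximal : Subset E → Set₁
  Maximal B = Ind B × (∀ J → Ind J → B ⊆ J → J ⊆ B)

  field
    ind-empty : Ind ∅
    ind-sub   : ∀ I J → J ⊆ I → Ind I → Ind J
    ind-aug   : ∀ I B → Ind I → Maximal B → ¬ Maximal I →
                ∃[ x ] (B x × ¬ I x × Ind (I +ₛ x))
    ind-max   : ∀ X I → I ⊆ X → Ind I → ∃[ B ] (I ⊆ B × MaximalIn X B)

open Matroid public

module _ {E : Set} (M : Matroid E) (X : Subset E) where
  -- Notions in the restriction M ↾ X (a matroid on ground set X).

  IndIn : Subset E → Set
  IndIn I = I ⊆ X × Ind M I

  DependentIn : Subset E → Set
  DependentIn D = D ⊆ X × ¬ Ind M D

  CircuitIn : Subset E → Set₁
  CircuitIn C = DependentIn C × (∀ D → D ⊆ C → DependentIn D → C ⊆ D)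

  SpansIn : Subset E → E → Set₁
  SpansIn A e = A e ⊎ ∃[ C ] (CircuitIn C × C e × (∀ y → C y → ¬ y ≡ e → A y))

  SpanningIn : Subset E → Set₁
  SpanningIn A = ∀ e → X e → SpansIn A e

module _ {E K : Set} (𝓜 : K → Matroid E) (X : Subset E) where

  CoveringOf : (K → Subset E) → Set
  CoveringOf R = (∀ i → IndIn (𝓜 i) X (R i)) × (∀ e → X e → ∃[ i ] R i e)

  AdmitsCovering : Set₁
  AdmitsCovering = ∃[ R ] CoveringOf R

  Tight : Set₁
  Tight = AdmitsCovering × (∀ R → CoveringOf R → ∀ i → SpanningIn (𝓜 i) X (R i))

module _ {E A : Set} where
  ⋃ : (A → Subset E) → Subset E
  ⋃ X e = ∃[ α ] X α e

  ⋂ : (A → Subset E) → Subset E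
  ⋂ X e = ∀ α → X α e

Whole : {E : Set} → Subset E
Whole _ = ⊤

-- Union: a covering of 𝓜 ↾ ⋃ X restricts to a covering of each 𝓜 ↾ X α, which is tight, so
-- every element of X α is spanned inside X α, hence inside ⋃ X.
--
-- Intersection (Y = ⋂ X): take a covering S of 𝓜 ↾ ⋃ X.  Since S k ∩ X α spans X α for every
-- α, the fundamental circuit of any y ∈ Y lies in every X α, so S k ∩ Y is a base of M k ↾ Y.
-- Given a covering R of 𝓜 ↾ Y, exchange the base S k ∩ Y for a base containing R k: the sets
-- R k ∪ (S k ∖ Y) are independent and cover every X α.  By tightness of X α, each e ∈ Y ∖ R j
-- has its fundamental circuit w.r.t. R j ∪ (S j ∖ Y) inside every X α, i.e. inside Y, so that
-- circuit minus e lies in R j, and R j spans e in M j ↾ Y.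
module Submission where

open import Defs
open import Level using (0ℓ)
open import Axiom.ExcludedMiddle using (ExcludedMiddle)
open import Data.Product using (_×_; _,_; proj₁; proj₂; ∃-syntax)
open import Data.Sum using (_⊎_; inj₁; inj₂)
open import Data.Empty using (⊥-elim)
open import Data.Unit using (tt)
open import Relation.Nullary using (¬_; yes; no)
open import Relation.Binary.PropositionalEquality using (_≡_; refl; sym; trans; subst)

module _ {E : Set} where

  _-ₛ_ : Subset E → E → Subset E
  (I -ₛ x) y = I y × ¬ y ≡ x

  _∪_ : Subset E → Subset E → Subset E
  (A ∪ B) y = A y ⊎ B y

  _∩_ : Subset E → Subset E → Subset E
  (A ∩ B) y = A y × B y

  _∖_ : Subset E → Subset E → Subset E
  (A ∖ B) y = A y × ¬ B y

  +ₛ-mono : ∀ (A B : Subset E) e → A ⊆ B → (A +ₛ e) ⊆ (B +ₛ e)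
  +ₛ-mono A B e A⊆B y (inj₁ Ay) = inj₁ (A⊆B y Ay)
  +ₛ-mono A B e A⊆B y (inj₂ y≡e) = inj₂ y≡e

module MatroidFacts (em : ExcludedMiddle 0ℓ) {E : Set} (M : Matroid E) where

  extend-to-base : ∀ I → Ind M I → ∃[ B ] (I ⊆ B × Maximal M B)
  extend-to-base I iI with ind-max M Whole I (λ _ _ → tt) iI
  ... | B , I⊆B , (_ , iB , mB) = B , I⊆B , iB , λ J iJ B⊆J → mB J (λ _ _ → tt) iJ B⊆J

  -- If Z contains a base, then every maximal independent subset of Z is a base:
  -- otherwise it could be augmented from that base, staying inside Z.
  maximalIn⇒base : ∀ Z B J → Maximal M B → B ⊆ Z → MaximalIn M Z J → Maximal M J
  maximalIn⇒base Z B J bB B⊆Z (J⊆Z , iJ , mJ) = iJ , maximal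
    where
    maximal : ∀ K → Ind M K → J ⊆ K → K ⊆ J
    maximal K iK J⊆K y Ky with em {J y}
    ... | yes Jy = Jy
    ... | no nJy with ind-aug M J B iJ bB (λ bJ → nJy (proj₂ bJ K iK J⊆K y Ky))
    ...   | x , Bx , nJx , iJx = ⊥-elim (nJx (mJ (J +ₛ x) J+x⊆Z iJx (λ _ → inj₁) x (inj₂ refl)))
      where
      J+x⊆Z : (J +ₛ x) ⊆ Z
      J+x⊆Z w (inj₁ Jw) = J⊆Z w Jw
      J+x⊆Z w (inj₂ refl) = B⊆Z x Bx

  exchange : ∀ B J f → Maximal M B → Maximal M J → B f → ¬ J f →
             ∃[ x ] (J x × ¬ B x × Ind M ((B -ₛ f) +ₛ x))
  exchange B J f (iB , mB) bJ Bf nJf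
    with ind-aug M (B -ₛ f) J (ind-sub M B (B -ₛ f) (λ _ → proj₁) iB) bJ
           (λ bB-f → proj₂ (proj₂ bB-f B iB (λ _ → proj₁) f Bf) refl)
  ... | x , Jx , x∉B-f , iB-f+x with em {B x}
  ...   | no nBx = x , Jx , nBx , iB-f+x
  ...   | yes Bx with em {x ≡ f}
  ...     | yes x≡f = ⊥-elim (nJf (subst J x≡f Jx))
  ...     | no x≢f = ⊥-elim (x∉B-f (Bx , x≢f))

  at-most-one-missing : ∀ B J e f g → Maximal M B → Maximal M J → J ⊆ (B +ₛ e) →
                        B f → ¬ J f → B g → ¬ J g → f ≡ g
  at-most-one-missing B J e f g bB (iJ , mJ) J⊆B+e Bf nJf Bg nJg with em {f ≡ g}
  ... | yes f≡g = f≡g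
  ... | no f≢g with exchange B J f bB (iJ , mJ) Bf nJf
  ...   | x , Jx , nBx , iB-f+x =
          ⊥-elim (nJg (mJ ((B -ₛ f) +ₛ x) iB-f+x J⊆B-f+x g (inj₁ (Bg , λ g≡f → f≢g (sym g≡f)))))
    where
    -- the exchanged element x must be e, so J ⊆ (B ∖ {f}) + x
    J⊆B-f+x : J ⊆ ((B -ₛ f) +ₛ x)
    J⊆B-f+x w Jw with J⊆B+e w Jw | J⊆B+e x Jx
    ... | inj₁ Bw | _ = inj₁ (Bw , λ w≡f → nJf (subst J w≡f Jw))
    ... | inj₂ _ | inj₁ Bx = ⊥-elim (nBx Bx)
    ... | inj₂ w≡e | inj₂ x≡e = inj₂ (trans w≡e (sym x≡e))

  -- For T independent, a maximal independent subset B of T + e omits at most one element of T.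
  -- (Extend both to bases Bp ⊇ T and J ⊇ B with J ⊆ B ∪ Bp, and compare them.)
  maximalIn-omits-at-most-one : ∀ T e B y z → Ind M T → MaximalIn M (T +ₛ e) B →
                                T y → ¬ B y → T z → ¬ B z → y ≡ z
  maximalIn-omits-at-most-one T e B y z iT (B⊆T+e , iB , mB) Ty nBy Tz nBz
    with extend-to-base T iT
  ... | Bp , T⊆Bp , bBp with ind-max M (B ∪ Bp) B (λ _ → inj₁) iB
  ... | J , B⊆J , maxJ =
        at-most-one-missing Bp J e y z bBp bJ J⊆Bp+e (T⊆Bp y Ty) (omits Ty nBy) (T⊆Bp z Tz) (omits Tz nBz)
    where
    bJ : Maximal M J
    bJ = maximalIn⇒base (B ∪ Bp) Bp J bBp (λ _ → inj₂) maxJ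
    J∩T+e⊆B : (J ∩ (T +ₛ e)) ⊆ B
    J∩T+e⊆B = mB (J ∩ (T +ₛ e)) (λ _ → proj₂) (ind-sub M J _ (λ _ → proj₁) (proj₁ bJ))
                 (λ w Bw → B⊆J w Bw , B⊆T+e w Bw)
    omits : ∀ {w} → T w → ¬ B w → ¬ J w
    omits {w} Tw nBw Jw = nBw (J∩T+e⊆B w (Jw , inj₁ Tw))
    J⊆Bp+e : J ⊆ (Bp +ₛ e)
    J⊆Bp+e w Jw with proj₁ maxJ w Jw
    ... | inj₂ Bpw = inj₁ Bpw
    ... | inj₁ Bw = +ₛ-mono T Bp e T⊆Bp w (B⊆T+e w Bw)

  module FundamentalCircuit (T : Subset E) (e : E) (iT : Ind M T) (dep : ¬ Ind M (T +ₛ e)) where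

    C : Subset E
    C y = y ≡ e ⊎ (T y × Ind M ((T +ₛ e) -ₛ y))

    C⊆T+e : C ⊆ (T +ₛ e)
    C⊆T+e y (inj₁ y≡e) = inj₂ y≡e
    C⊆T+e y (inj₂ (Ty , _)) = inj₁ Ty

    C-removal : ∀ y → C y → Ind M ((T +ₛ e) -ₛ y)
    C-removal y (inj₂ (_ , ind)) = ind
    C-removal y (inj₁ y≡e) = ind-sub M T _ into-T iT
      where
      into-T : ((T +ₛ e) -ₛ y) ⊆ T
      into-T w (inj₁ Tw , _) = Tw
      into-T w (inj₂ w≡e , w≢y) = ⊥-elim (w≢y (trans w≡e (sym y≡e)))

    C-min : ∀ D → D ⊆ (T +ₛ e) → ¬ Ind M D → C ⊆ D
    C-min D D⊆T+e nD y Cy with em {D y}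
    ... | yes Dy = Dy
    ... | no nDy = ⊥-elim (nD (ind-sub M _ D D⊆T+e-y (C-removal y Cy)))
      where
      D⊆T+e-y : D ⊆ ((T +ₛ e) -ₛ y)
      D⊆T+e-y w Dw = D⊆T+e w Dw , λ w≡y → nDy (subst D w≡y Dw)

    -- C is dependent: a maximal independent B ⊇ C inside T + e would omit at most one y ∈ T,
    -- and then (T + e) ∖ {y} ⊆ B would put y into C ⊆ B; so T + e ⊆ B, contradicting 'dep'.
    C-dep : ¬ Ind M C
    C-dep iC with ind-max M (T +ₛ e) C C⊆T+e iC
    ... | B , C⊆B , maxB = dep (ind-sub M B (T +ₛ e) T+e⊆B (proj₁ (proj₂ maxB)))
      where
      e∈B : B e
      e∈B = C⊆B e (inj₁ refl)
      T⊆B : T ⊆ B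
      T⊆B y Ty with em {B y}
      ... | yes By = By
      ... | no nBy = ⊥-elim (nBy (C⊆B y (inj₂ (Ty , ind-sub M B _ T+e-y⊆B (proj₁ (proj₂ maxB))))))
        where
        T+e-y⊆B : ((T +ₛ e) -ₛ y) ⊆ B
        T+e-y⊆B z (inj₂ z≡e , _) = subst B (sym z≡e) e∈B
        T+e-y⊆B z (inj₁ Tz , z≢y) with em {B z}
        ... | yes Bz = Bz
        ... | no nBz = ⊥-elim (z≢y (sym (maximalIn-omits-at-most-one T e B y z iT maxB Ty nBy Tz nBz)))
      T+e⊆B : (T +ₛ e) ⊆ B
      T+e⊆B w (inj₁ Tw) = T⊆B w Tw
      T+e⊆B w (inj₂ w≡e) = subst B (sym w≡e) e∈B

    C-circuit : ∀ X → C ⊆ X → CircuitIn M X C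
    C-circuit X C⊆X = (C⊆X , C-dep) , λ D D⊆C nD → C-min D (λ w Dw → C⊆T+e w (D⊆C w Dw)) (proj₂ nD)

  spans⇒dependent : ∀ X A e → ¬ A e → SpansIn M X A e → ∃[ D ] (D ⊆ X × D ⊆ (A +ₛ e) × ¬ Ind M D)
  spans⇒dependent X A e e∉A (inj₁ Ae) = ⊥-elim (e∉A Ae)
  spans⇒dependent X A e e∉A (inj₂ (D , ((D⊆X , nD) , _) , _ , D-e⊆A)) = D , D⊆X , D⊆A+e , nD
    where
    D⊆A+e : D ⊆ (A +ₛ e)
    D⊆A+e y Dy with em {y ≡ e}
    ... | yes y≡e = inj₂ y≡e
    ... | no y≢e = inj₁ (D-e⊆A y Dy y≢e)

  module CircuitInIntersection {A : Set} (a : A) (X : A → Subset E) (T : Subset E) (e : E)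
      (iT : Ind M T) (e∉T : ¬ T e) (spans : ∀ α → SpansIn M (X α) (T ∩ X α) e) where

    dependent-in : ∀ α → ∃[ D ] (D ⊆ X α × D ⊆ (T +ₛ e) × ¬ Ind M D)
    dependent-in α with spans⇒dependent (X α) (T ∩ X α) e (λ p → e∉T (proj₁ p)) (spans α)
    ... | D , D⊆X , D⊆ , nD = D , D⊆X , (λ y Dy → +ₛ-mono (T ∩ X α) T e (λ _ → proj₁) y (D⊆ y Dy)) , nD

    T+e-dependent : ¬ Ind M (T +ₛ e)
    T+e-dependent iT+e with dependent-in a
    ... | D , _ , D⊆T+e , nD = nD (ind-sub M _ D D⊆T+e iT+e)

    open FundamentalCircuit T e iT T+e-dependent public

    C⊆⋂X : C ⊆ ⋂ X
    C⊆⋂X y Cy α with dependent-in α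
    ... | D , D⊆X , D⊆T+e , nD = D⊆X y (C-min D D⊆T+e nD y Cy)

  -- If T is independent and T ∩ X α is spanning in M ↾ X α for all α, then T ∩ ⋂ X is a
  -- base of M ↾ ⋂ X: any further y ∈ ⋂ X has its fundamental circuit inside T ∩ ⋂ X.
  maximal-in-intersection : ∀ {A} → A → (X : A → Subset E) → ∀ T → Ind M T →
    (∀ α → SpanningIn M (X α) (T ∩ X α)) → MaximalIn M (⋂ X) (T ∩ ⋂ X)
  maximal-in-intersection a X T iT spanning = (λ _ → proj₂) , ind-sub M T _ (λ _ → proj₁) iT , maximal
    where
    maximal : ∀ J → J ⊆ ⋂ X → Ind M J → (T ∩ ⋂ X) ⊆ J → J ⊆ (T ∩ ⋂ X)
    maximal J J⊆⋂X iJ T∩⋂X⊆J y Jy with em {T y}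
    ... | yes Ty = Ty , J⊆⋂X y Jy
    ... | no nTy = ⊥-elim (C-dep (ind-sub M J C C⊆J iJ))
      where
      open CircuitInIntersection a X T y iT nTy (λ α → spanning α y (J⊆⋂X y Jy α))
      C⊆J : C ⊆ J
      C⊆J z Cz with C⊆T+e z Cz
      ... | inj₁ Tz = T∩⋂X⊆J z (Tz , C⊆⋂X z Cz)
      ... | inj₂ z≡y = subst J (sym z≡y) Jy

  swap-restricted-base : ∀ Y B B' I → MaximalIn M Y B → MaximalIn M Y B' →
                         (∀ x → I x → ¬ Y x) → Ind M (B ∪ I) → Ind M (B' ∪ I)
  swap-restricted-base Y B B' I (B⊆Y , _ , mB) (B'⊆Y , iB' , _) I∩Y≡∅ iB∪I
    with extend-to-base (B ∪ I) iB∪I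
  ... | Bs , B∪I⊆Bs , bBs with ind-max M (B' ∪ Bs) B' (λ _ → inj₁) iB'
  ... | J , B'⊆J , maxJ = ind-sub M J (B' ∪ I) B'∪I⊆J (proj₁ bJ)
    where
    bJ : Maximal M J
    bJ = maximalIn⇒base (B' ∪ Bs) Bs J bBs (λ _ → inj₂) maxJ
    absorbed : ∀ i x → I i → Y x → Ind M ((Bs -ₛ i) +ₛ x) → B x
    absorbed i x Ii Yx iBs-i+x = mB (B +ₛ x) B+x⊆Y (ind-sub M _ _ B+x⊆Bs-i+x iBs-i+x) (λ _ → inj₁) x (inj₂ refl)
      where
      B+x⊆Y : (B +ₛ x) ⊆ Y
      B+x⊆Y w (inj₁ Bw) = B⊆Y w Bw
      B+x⊆Y w (inj₂ refl) = Yx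
      B+x⊆Bs-i+x : (B +ₛ x) ⊆ ((Bs -ₛ i) +ₛ x)
      B+x⊆Bs-i+x w (inj₁ Bw) = inj₁ (B∪I⊆Bs w (inj₁ Bw) , λ w≡i → I∩Y≡∅ i Ii (subst Y w≡i (B⊆Y w Bw)))
      B+x⊆Bs-i+x w (inj₂ w≡x) = inj₂ w≡x
    I⊆J : I ⊆ J
    I⊆J i Ii with em {J i}
    ... | yes Ji = Ji
    ... | no nJi with exchange Bs J i bBs bJ (B∪I⊆Bs i (inj₂ Ii)) nJi
    ...   | x , Jx , nBsx , iBs-i+x with proj₁ maxJ x Jx
    ...     | inj₂ Bsx = ⊥-elim (nBsx Bsx)
    ...     | inj₁ B'x = ⊥-elim (nBsx (B∪I⊆Bs x (inj₁ (absorbed i x Ii (B'⊆Y x B'x) iBs-i+x))))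
    B'∪I⊆J : (B' ∪ I) ⊆ J
    B'∪I⊆J w (inj₁ B'w) = B'⊆J w B'w
    B'∪I⊆J w (inj₂ Iw) = I⊆J w Iw

module _ {E K : Set} (𝓜 : K → Matroid E) where

  restrict-covering : ∀ {Z W R} → CoveringOf 𝓜 Z R → W ⊆ Z → CoveringOf 𝓜 W (λ i → R i ∩ W)
  restrict-covering {R = R} (indR , covR) W⊆Z =
    (λ i → (λ _ → proj₂) , ind-sub (𝓜 i) (R i) _ (λ _ → proj₁) (proj₂ (indR i))) ,
    λ x Wx → proj₁ (covR x (W⊆Z x Wx)) , proj₂ (covR x (W⊆Z x Wx)) , Wx

  spans-mono : ∀ {W Z A B : Subset E} {e} i → W ⊆ Z → A ⊆ B → SpansIn (𝓜 i) W A e → SpansIn (𝓜 i) Z B e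
  spans-mono i W⊆Z A⊆B (inj₁ Ae) = inj₁ (A⊆B _ Ae)
  spans-mono {Z = Z} i W⊆Z A⊆B (inj₂ (C , ((C⊆W , nC) , minC) , Ce , C-e⊆A)) =
    inj₂ (C , circuit , Ce , λ y Cy y≢e → A⊆B y (C-e⊆A y Cy y≢e))
    where
    circuit : CircuitIn (𝓜 i) Z C
    circuit = ((λ x Cx → W⊆Z x (C⊆W x Cx)) , nC) ,
              λ D D⊆C nD → minC D D⊆C ((λ x Dx → C⊆W x (D⊆C x Dx)) , proj₂ nD)

  -- Union: restrict a covering of ⋃ X to each X α and use tightness of X α.
  union-tight : ∀ {A} (X : A → Subset E) → AdmitsCovering 𝓜 (⋃ X) → (∀ α → Tight 𝓜 (X α)) → Tight 𝓜 (⋃ X)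
  union-tight X admits tight = admits , spanning
    where
    spanning : ∀ R → CoveringOf 𝓜 (⋃ X) R → ∀ i → SpanningIn (𝓜 i) (⋃ X) (R i)
    spanning R covR i e (α , Xαe) =
      spans-mono i (λ x Xαx → α , Xαx) (λ _ → proj₁)
        (proj₂ (tight α) (λ k → R k ∩ X α) (restrict-covering covR (λ x Xαx → α , Xαx)) i e Xαe)

module Intersection (em : ExcludedMiddle 0ℓ) {E K : Set} (𝓜 : K → Matroid E)
    {A : Set} (a : A) (X : A → Subset E) (tight : ∀ α → Tight 𝓜 (X α))
    (S : K → Subset E) (covS : CoveringOf 𝓜 (⋃ X) S) where

  open module Facts {k} = MatroidFacts em (𝓜 k)

  Y : Subset E
  Y = ⋂ X

  -- S k ∩ Y is a base of M k ↾ Y, because S k ∩ X α is spanning in M k ↾ X α for every α.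
  S∩Y-base : ∀ k → MaximalIn (𝓜 k) Y (S k ∩ Y)
  S∩Y-base k = maximal-in-intersection a X (S k) (proj₂ (proj₁ covS k)) spanning
    where
    spanning : ∀ α → SpanningIn (𝓜 k) (X α) (S k ∩ X α)
    spanning α = proj₂ (tight α) _ (restrict-covering 𝓜 covS (λ x Xαx → α , Xαx)) k

  module _ (R : K → Subset E) (covR : CoveringOf 𝓜 Y R) where

    P : K → Subset E
    P k = R k ∪ (S k ∖ Y)

    -- P k is independent: extend R k to a base R' of M k ↾ Y and swap it for S k ∩ Y.
    P-independent : ∀ k → Ind (𝓜 k) (P k)
    P-independent k with ind-max (𝓜 k) Y (R k) (proj₁ (proj₁ covR k)) (proj₂ (proj₁ covR k))
    ... | R' , R⊆R' , R'-base = ind-sub (𝓜 k) _ (P k) P⊆R'∪S∖Y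
          (swap-restricted-base Y _ R' (S k ∖ Y) (S∩Y-base k) R'-base (λ _ → proj₂)
            (ind-sub (𝓜 k) (S k) _ S∩Y∪S∖Y⊆S (proj₂ (proj₁ covS k))))
      where
      P⊆R'∪S∖Y : P k ⊆ (R' ∪ (S k ∖ Y))
      P⊆R'∪S∖Y x (inj₁ Rx) = inj₁ (R⊆R' x Rx)
      P⊆R'∪S∖Y x (inj₂ p) = inj₂ p
      S∩Y∪S∖Y⊆S : ((S k ∩ Y) ∪ (S k ∖ Y)) ⊆ S k
      S∩Y∪S∖Y⊆S x (inj₁ p) = proj₁ p
      S∩Y∪S∖Y⊆S x (inj₂ p) = proj₁ p

    P-covers : ∀ α → CoveringOf 𝓜 (X α) (λ k → P k ∩ X α)
    P-covers α = (λ k → (λ _ → proj₂) , ind-sub (𝓜 k) (P k) _ (λ _ → proj₁) (P-independent k)) , cover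
      where
      cover : ∀ x → X α x → ∃[ k ] ((P k ∩ X α) x)
      cover x Xαx with em {Y x}
      ... | yes Yx = proj₁ (proj₂ covR x Yx) , inj₁ (proj₂ (proj₂ covR x Yx)) , Xαx
      ... | no nYx with proj₂ covS x (α , Xαx)
      ...   | k , Sx = k , inj₂ (Sx , nYx) , Xαx

    -- R j spans every e ∈ Y: the fundamental circuit of e w.r.t. P j lies in Y, so it meets
    -- P j only in R j.
    R-spanning : ∀ j → SpanningIn (𝓜 j) Y (R j)
    R-spanning j e Ye with em {R j e}
    ... | yes Re = inj₁ Re
    ... | no nRe = inj₂ (C , C-circuit Y C⊆⋂X , inj₁ refl , C-e⊆R)
      where
      e∉P : ¬ P j e
      e∉P (inj₁ Re) = nRe Re
      e∉P (inj₂ (_ , nYe)) = nYe Ye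
      open CircuitInIntersection a X (P j) e (P-independent j) e∉P
        (λ α → proj₂ (tight α) _ (P-covers α) j e (Ye α))
      C-e⊆R : ∀ y → C y → ¬ y ≡ e → R j y
      C-e⊆R y Cy y≢e with C⊆T+e y Cy
      ... | inj₂ y≡e = ⊥-elim (y≢e y≡e)
      ... | inj₁ (inj₁ Ry) = Ry
      ... | inj₁ (inj₂ (_ , nYy)) = ⊥-elim (nYy (C⊆⋂X y Cy))

  intersection-tight : Tight 𝓜 Y
  intersection-tight = (_ , restrict-covering 𝓜 covS (λ x Yx → a , Yx a)) , R-spanning

proposition3p6 : ExcludedMiddle 0ℓ → ExcludedMiddle (Level.suc 0ℓ) →
    {E K : Set} (𝓜 : K → Matroid E) → AdmitsCovering 𝓜 Whole →
    {A : Set} → A → (X : A → Subset E) → (∀ α → Tight 𝓜 (X α)) →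
    Tight 𝓜 (⋃ X) × Tight 𝓜 (⋂ X)
proposition3p6 em _ {E} {K} 𝓜 (G , covG) a X tight = ⋃X-tight , Intersection.intersection-tight em 𝓜 a X tight S covS
  where
  S : K → Subset E
  S k = G k ∩ ⋃ X
  covS : CoveringOf 𝓜 (⋃ X) S
  covS = restrict-covering 𝓜 covG (λ _ _ → tt)
  ⋃X-tight : Tight 𝓜 (⋃ X)
  ⋃X-tight = union-tight 𝓜 X (S , covS) tight
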